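{- Let $k\in\mathbb N$, let $V$ be a finite set, let $\mathcal C$ be a set of XOR-constraints over $V$ of arity at most $k$, and let $r\ge 0$. Let $\beta\colon X\to\{0,1\}$ be a partial assignment with $X\subseteq V$, $|X|\le k$, such that $\beta$ violates no XOR-constraint in $\mathrm{cl}_k^{(r)}(\mathcal C)$. Then Verifier wins $\mathcal G^r_k(V,\mathcal C,\beta)$.
   Context: An XOR-constraint over $V$ is a pair $(C,a)$ with $C\subseteq V$, $a\in\{0,1\}$; arity of $\mathcal C$ is the maximal $|C|$. $\beta$ violates $(C,a)$ if $C\subseteq X$ and $\sum_{x\in C}\beta(x)\not\equiv a\pmod 2$. The $k$-attractor of a set $\mathcal C$ is $\mathrm{attr}_k(\mathcal C)=\mathcal C\cup\{(C_1\oplus C_2,\,a_1+a_2\bmod 2)\mid (C_1,a_1),(C_2,a_2)\in\mathcal C,\ |C_1\oplus C_2|\le k\}$, where $\oplus$ is symmetric difference; $\mathrm{cl}^{(0)}_k(\mathcal C)=\mathcal C$ and $\mathrm{cl}_k^{(r+1)}(\mathcal C)=\mathrm{attr}_k(\mathrm{cl}_k^{(r)}(\mathcal C))$. The $r$-round $k$-pebble game $\mathcal G^r_k(V,\mathcal C,\beta_0)$ starts at position $\beta_0$; in each round at position $\beta\colon X\to\{0,1\}$ Falsifier picks $x\in V\setminus X$ and $X'\subseteq X$ with $|X'\cup\{x\}|\le k$, Verifier picks $b\in\{0,1\}$, and the position becomes $\beta'$ on $X'\cup\{x\}$ with $\beta'|_{X'}=\beta|_{X'}$, $\beta'(x)=b$.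 Falsifier wins a play if within the first $r$ rounds some position (including the initial one) violates a constraint of $\mathcal C$; otherwise Verifier wins. Winning the game means having a winning strategy. -}

module Defs where

open import Data.Nat using (ℕ; zero; suc; _≤_)
open import Data.Bool using (Bool; true; false; _xor_; _∧_; if_then_else_)
open import Data.Maybe using (Maybe; just; nothing; is-just; fromMaybe)
open import Data.Fin using (Fin; _≟_)
open import Data.Fin.Subset using (Subset; _⊆_; _∪_; ⁅_⁆; ∣_∣; _∉_)
open import Data.Vec using (tabulate; zipWith; lookup)
open import Data.List using (List; foldr; allFin)
open import Data.List.Membership.Propositional using (_∈_)
open import Data.Product using (_×_; _,_; ∃-syntax)
open import Data.Sum using (_⊎_)
open import Relation.Binary.PropositionalEquality using (_≡_; _≢_)
open import Relation.Nullary using (¬_; does)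

-- The variable set V is Fin n.  An XOR-constraint (C , a): C ⊆ V, a ∈ {0,1}.
Constraint : ℕ → Set
Constraint n = Subset n × Bool

_⊕_ : ∀ {n} → Subset n → Subset n → Subset n
_⊕_ = zipWith _xor_

-- A partial assignment β : X → {0,1}, X ⊆ V (nothing = unassigned).
Assignment : ℕ → Set
Assignment n = Fin n → Maybe Bool

dom : ∀ {n} → Assignment n → Subset n
dom β = tabulate (λ i → is-just (β i))

parity : ∀ {n} → Assignment n → Subset n → Bool
parity {n} β C = foldr (λ i acc → (lookup C i ∧ fromMaybe false (β i)) xor acc) false (allFin n)

Violates : ∀ {n} → Assignment n → Constraint n → Set
Violates β (C , a) = (C ⊆ dom β) × (parity β C ≢ a)

ConstraintSet : ℕ → Set₁
ConstraintSet n = Constraint n → Set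

listSet : ∀ {n} → List (Constraint n) → ConstraintSet n
listSet 𝒞 c = c ∈ 𝒞

attr : ∀ {n} → ℕ → ConstraintSet n → ConstraintSet n
attr k 𝒞 (D , d) =
  𝒞 (D , d) ⊎
  ∃[ C₁ ] ∃[ a₁ ] ∃[ C₂ ] ∃[ a₂ ]
    (𝒞 (C₁ , a₁) × 𝒞 (C₂ , a₂) × ∣ C₁ ⊕ C₂ ∣ ≤ k × D ≡ C₁ ⊕ C₂ × d ≡ a₁ xor a₂)

cl : ∀ {n} → ℕ → ℕ → ConstraintSet n → ConstraintSet n
cl k zero 𝒞 = 𝒞
cl k (suc r) 𝒞 = attr k (cl k r 𝒞)

NoViolation : ∀ {n} → ConstraintSet n → Assignment n → Set
NoViolation 𝒞 β = ∀ c → 𝒞 c → ¬ Violates β c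

move : ∀ {n} → Assignment n → Subset n → Fin n → Bool → Assignment n
move β X' x b i with does (i ≟ x)
... | true = just b
... | false = if lookup X' i then β i else nothing

-- Verifier wins the r-round k-pebble game G^r_k(V, 𝒞, β):
-- no position among the first r rounds (incl. the initial one) violates 𝒞.
VerifierWins : ∀ {n} → ℕ → ConstraintSet n → ℕ → Assignment n → Set
VerifierWins k 𝒞 zero β = NoViolation 𝒞 β
VerifierWins k 𝒞 (suc r) β =
  NoViolation 𝒞 β ×
  (∀ (x : Fin _) → x ∉ dom β → ∀ (X' : Subset _) → X' ⊆ dom β → ∣ X' ∪ ⁅ x ⁆ ∣ ≤ k →
     ∃[ b ] VerifierWins k 𝒞 r (move β X' x b))

{-# OPTIONS --safe #-}
module Submission where

open import Defs
open import Algebra using (CommutativeRing)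
open import Data.Nat using (ℕ; zero; suc; _≤_; _≤?_)
open import Data.Nat.Properties using (≤-trans)
open import Data.Bool using (Bool; true; false; not; _xor_; _∧_)
open import Data.Bool.Properties
  using (¬-not; not-¬; not-injective; true-xor; xor-comm; ∧-distribʳ-xor; ∧-distribˡ-xor; ∧-identityʳ; ∧-zeroʳ; xor-identityʳ; not-distribˡ-xor; xor-∧-commutativeRing)
  renaming (_≟_ to _≟ᵇ_)
open import Algebra.Properties.CommutativeSemigroup
  (CommutativeRing.+-commutativeSemigroup xor-∧-commutativeRing) using (interchange)
open import Data.Maybe using (is-just; fromMaybe)
open import Data.Fin using (Fin; zero; suc; _≟_)
open import Data.Fin.Subset using (Subset; _⊆_; _∪_; ⁅_⁆; ∣_∣; _∈_; _∉_)
open import Data.Fin.Subset.Properties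
  using (anySubset?; _⊆?_; p⊆q⇒∣p∣≤∣q∣; p⊆p∪q; x∈p∪q⁺; x∈p∪q⁻; x∈⁅x⁆; x∈⁅y⁆⇒x≡y)
  renaming (_∈?_ to _∈ˢ?_)
open import Data.Vec using (lookup)
open import Data.Vec.Properties using (lookup∘tabulate; lookup-zipWith; []=⇒lookup; lookup⇒[]=)
  renaming (≡-dec to Vec-≡-dec)
open import Data.List using (List; []; _∷_; foldr; allFin)
import Data.List as List
open import Data.List.Membership.DecPropositional using (_∈?_)
open import Data.List.Membership.Propositional using () renaming (_∈_ to _∈L_)
open import Data.Product using (_×_; _,_; ∃; ∃-syntax)
open import Data.Product.Properties using () renaming (≡-dec to ×-≡-dec)
open import Data.Sum using (inj₁; inj₂)
open import Data.Empty using (⊥-elim)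
open import Function using (_∘_)
open import Relation.Binary.PropositionalEquality using (_≡_; _≢_; refl; sym; trans; cong; cong₂; module ≡-Reasoning)
open import Relation.Nullary using (does; Dec; yes; no)
open import Relation.Nullary.Decidable using (_⊎-dec_; _×-dec_; ¬?; map′)
open import Relation.Unary using (Decidable)

private variable
  n k : ℕ

xorSum : (Fin n → Bool) → List (Fin n) → Bool
xorSum f = foldr (λ i acc → f i xor acc) false

xorSum-cong : ∀ {f g : Fin n → Bool} → (∀ i → f i ≡ g i) → ∀ l → xorSum f l ≡ xorSum g l
xorSum-cong f≗g []      = refl
xorSum-cong f≗g (i ∷ l) = cong₂ _xor_ (f≗g i) (xorSum-cong f≗g l)

xorSum-xor : ∀ (f g : Fin n → Bool) l → xorSum (λ i → f i xor g i) l ≡ xorSum f l xor xorSum g l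
xorSum-xor f g []      = refl
xorSum-xor f g (i ∷ l) = trans (cong ((f i xor g i) xor_) (xorSum-xor f g l)) (interchange (f i) (g i) _ _)

xorSum-zero : ∀ {f : Fin n → Bool} → (∀ i → f i ≡ false) → ∀ l → xorSum f l ≡ false
xorSum-zero f≗0 []      = refl
xorSum-zero f≗0 (i ∷ l) = cong₂ _xor_ (f≗0 i) (xorSum-zero f≗0 l)

xorSum-tabulate : ∀ {m} (f : Fin n → Bool) (g : Fin m → Fin n) →
  xorSum f (List.tabulate g) ≡ xorSum (f ∘ g) (allFin m)
xorSum-tabulate {m = zero}  f g = refl
xorSum-tabulate {m = suc m} f g = cong (f (g zero) xor_)
  (trans (xorSum-tabulate f (g ∘ suc)) (sym (xorSum-tabulate (f ∘ g) suc)))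

xorSum-δ : ∀ (f : Fin n → Bool) x → xorSum (λ i → f i ∧ does (i ≟ x)) (allFin n) ≡ f x
xorSum-δ {suc n} f zero = trans
  (cong₂ _xor_ (∧-identityʳ (f zero))
               (trans (xorSum-tabulate (λ i → f i ∧ does (i ≟ zero)) suc)
                      (xorSum-zero (λ i → ∧-zeroʳ (f (suc i))) (allFin n))))
  (xor-identityʳ (f zero))
xorSum-δ {suc n} f (suc x) = cong₂ _xor_ (∧-zeroʳ (f zero))
  (trans (xorSum-tabulate (λ i → f i ∧ does (i ≟ suc x)) suc) (xorSum-δ (f ∘ suc) x))

value : Assignment n → Fin n → Bool
value β i = fromMaybe false (β i)

parity-cong : ∀ {β γ : Assignment n} {C} → (∀ {i} → i ∈ C → β i ≡ γ i) → parity β C ≡ parity γ C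
parity-cong {n} {β} {γ} {C} agree = xorSum-cong pointwise (allFin n)
  where
  pointwise : ∀ i → lookup C i ∧ value β i ≡ lookup C i ∧ value γ i
  pointwise i with lookup C i in i∈C
  ... | false = refl
  ... | true  = cong (fromMaybe false) (agree (lookup⇒[]= i C i∈C))

parity-⊕ : ∀ (β : Assignment n) C₁ C₂ → parity β (C₁ ⊕ C₂) ≡ parity β C₁ xor parity β C₂
parity-⊕ {n} β C₁ C₂ = trans (xorSum-cong pointwise (allFin n))
  (xorSum-xor (λ i → lookup C₁ i ∧ value β i) (λ i → lookup C₂ i ∧ value β i) (allFin n))
  where
  pointwise : ∀ i → lookup (C₁ ⊕ C₂) i ∧ value β i ≡ (lookup C₁ i ∧ value β i) xor (lookup C₂ i ∧ value β i)
  pointwise i = trans (cong (_∧ value β i) (lookup-zipWith _xor_ i C₁ C₂))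
                      (∧-distribʳ-xor (value β i) (lookup C₁ i) (lookup C₂ i))

parity-toggle : ∀ {β γ : Assignment n} x → (∀ i → value γ i ≡ value β i xor does (i ≟ x)) →
  ∀ C → parity γ C ≡ parity β C xor lookup C x
parity-toggle {n} {β} {γ} x toggle C = begin
  parity γ C
    ≡⟨ xorSum-cong (λ i → trans (cong (lookup C i ∧_) (toggle i)) (∧-distribˡ-xor (lookup C i) _ _)) (allFin n) ⟩
  xorSum (λ i → (lookup C i ∧ value β i) xor (lookup C i ∧ does (i ≟ x))) (allFin n)
    ≡⟨ xorSum-xor (λ i → lookup C i ∧ value β i) (λ i → lookup C i ∧ does (i ≟ x)) (allFin n) ⟩
  parity β C xor xorSum (λ i → lookup C i ∧ does (i ≟ x)) (allFin n)
    ≡⟨ cong (parity β C xor_) (xorSum-δ (lookup C) x) ⟩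
  parity β C xor lookup C x ∎
  where open ≡-Reasoning

∪-⊆ : ∀ {p q r : Subset n} → p ⊆ r → q ⊆ r → p ∪ q ⊆ r
∪-⊆ {p = p} {q} p⊆r q⊆r i∈p∪q with x∈p∪q⁻ p q i∈p∪q
... | inj₁ i∈p = p⊆r i∈p
... | inj₂ i∈q = q⊆r i∈q

⊆-∪⁅⁆ : ∀ {C Y : Subset n} {x} → C ⊆ Y ∪ ⁅ x ⁆ → x ∉ C → C ⊆ Y
⊆-∪⁅⁆ {C = C} {Y} {x} C⊆Y+x x∉C i∈C with x∈p∪q⁻ Y ⁅ x ⁆ (C⊆Y+x i∈C)
... | inj₁ i∈Y = i∈Y
... | inj₂ i∈⁅x⁆ with refl ← x∈⁅y⁆⇒x≡y x i∈⁅x⁆ = ⊥-elim (x∉C i∈C)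

⊕-⊆-∪ : ∀ {C₁ C₂ : Subset n} → C₁ ⊕ C₂ ⊆ C₁ ∪ C₂
⊕-⊆-∪ {C₁ = C₁} {C₂} {i} i∈⊕ with lookup C₁ i in i∈C₁ | trans (sym (lookup-zipWith _xor_ i C₁ C₂)) ([]=⇒lookup i∈⊕)
... | true  | _    = x∈p∪q⁺ (inj₁ (lookup⇒[]= i C₁ i∈C₁))
... | false | i∈C₂ = x∈p∪q⁺ (inj₂ (lookup⇒[]= i C₂ i∈C₂))

∈-⊕-∈ : ∀ {C₁ C₂ : Subset n} {x} → x ∈ C₁ → x ∈ C₂ → x ∉ C₁ ⊕ C₂
∈-⊕-∈ {C₁ = C₁} {C₂} {x} x∈C₁ x∈C₂ x∈⊕
  with () ← trans (sym ([]=⇒lookup x∈⊕))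
                  (trans (lookup-zipWith _xor_ x C₁ C₂) (cong₂ _xor_ ([]=⇒lookup x∈C₁) ([]=⇒lookup x∈C₂)))

∈-dom⁻ : ∀ (β : Assignment n) {i} → i ∈ dom β → is-just (β i) ≡ true
∈-dom⁻ β {i} i∈ = trans (sym (lookup∘tabulate _ i)) ([]=⇒lookup i∈)

dom-move : ∀ (β : Assignment n) X' x b → dom (move β X' x b) ⊆ X' ∪ ⁅ x ⁆
dom-move β X' x b {i} i∈ with i ≟ x | ∈-dom⁻ (move β X' x b) i∈
... | yes refl | _ = x∈p∪q⁺ (inj₂ (x∈⁅x⁆ x))
... | no _     | just-i with lookup X' i in i∈X' | just-i
...   | true  | _  = x∈p∪q⁺ (inj₁ (lookup⇒[]= i X' i∈X'))
...   | false | ()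

move-agrees : ∀ (β : Assignment n) {X' x} b {i} → i ∈ X' → i ≢ x → move β X' x b i ≡ β i
move-agrees β {X'} {x} b {i} i∈X' i≢x with i ≟ x
... | yes i≡x = ⊥-elim (i≢x i≡x)
... | no _ rewrite []=⇒lookup i∈X' = refl

move-toggle : ∀ (β : Assignment n) X' x i →
  value (move β X' x true) i ≡ value (move β X' x false) i xor does (i ≟ x)
move-toggle β X' x i with does (i ≟ x)
... | true  = refl
... | false = sym (xor-identityʳ _)

module _ {β : Assignment n} {X' : Subset n} {x : Fin n} (X'⊆X : X' ⊆ dom β) (x∉X : x ∉ dom β) where

  parity-move : ∀ b {C} → C ⊆ X' → parity (move β X' x b) C ≡ parity β C
  parity-move b C⊆X' = parity-cong λ i∈C → move-agrees β b (C⊆X' i∈C) λ { refl → x∉X (X'⊆X (C⊆X' i∈C)) }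

  Violates-move⇒Violates : ∀ {b C a} → x ∉ C → Violates (move β X' x b) (C , a) → Violates β (C , a)
  Violates-move⇒Violates {b} x∉C (C⊆X+ , wrong) =
    X'⊆X ∘ C⊆X' , λ right → wrong (trans (parity-move b C⊆X') right)
    where C⊆X' = ⊆-∪⁅⁆ (dom-move β X' x b ∘ C⊆X+) x∉C

  Violates-both-moves⇒Violates-⊕ : ∀ {C₁ a₁ C₂ a₂} → x ∈ C₁ → x ∈ C₂ →
    Violates (move β X' x false) (C₁ , a₁) → Violates (move β X' x true) (C₂ , a₂) →
    C₁ ⊕ C₂ ⊆ X' × Violates β (C₁ ⊕ C₂ , a₁ xor a₂)
  Violates-both-moves⇒Violates-⊕ {C₁} {a₁} {C₂} {a₂} x∈C₁ x∈C₂ (C₁⊆X₀ , wrong₁) (C₂⊆X₁ , wrong₂) =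
    D⊆X' , X'⊆X ∘ D⊆X' , λ right → not-¬ refl (trans (sym right) parity-D)
    where
    open ≡-Reasoning
    γ : Bool → Assignment _
    γ b = move β X' x b
    D⊆X' : C₁ ⊕ C₂ ⊆ X'
    D⊆X' = ⊆-∪⁅⁆ (∪-⊆ (dom-move β X' x false ∘ C₁⊆X₀) (dom-move β X' x true ∘ C₂⊆X₁) ∘ ⊕-⊆-∪)
                 (∈-⊕-∈ x∈C₁ x∈C₂)
    parity-C₂ : parity (γ false) C₂ ≡ a₂
    parity-C₂ = not-injective (begin
      not (parity (γ false) C₂)         ≡⟨ sym (trans (xor-comm _ true) (true-xor _)) ⟩
      parity (γ false) C₂ xor true      ≡⟨ cong (parity (γ false) C₂ xor_) (sym ([]=⇒lookup x∈C₂)) ⟩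
      parity (γ false) C₂ xor lookup C₂ x ≡⟨ sym (parity-toggle {β = γ false} {γ true} x (move-toggle β X' x) C₂) ⟩
      parity (γ true) C₂                ≡⟨ ¬-not wrong₂ ⟩
      not a₂                            ∎)
    parity-D : parity β (C₁ ⊕ C₂) ≡ not (a₁ xor a₂)
    parity-D = begin
      parity β (C₁ ⊕ C₂)                          ≡⟨ sym (parity-move false D⊆X') ⟩
      parity (γ false) (C₁ ⊕ C₂)                  ≡⟨ parity-⊕ (γ false) C₁ C₂ ⟩
      parity (γ false) C₁ xor parity (γ false) C₂ ≡⟨ cong₂ _xor_ (¬-not wrong₁) parity-C₂ ⟩
      not a₁ xor a₂                               ≡⟨ sym (not-distribˡ-xor a₁ a₂) ⟩
      not (a₁ xor a₂)                             ∎

anyBool? : ∀ {P : Bool → Set} → Decidable P → Dec (∃ P)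
anyBool? P? = map′ (λ { (inj₁ p) → false , p ; (inj₂ p) → true , p })
                   (λ { (false , p) → inj₁ p ; (true , p) → inj₂ p })
                   (P? false ⊎-dec P? true)

anyConstraint? : ∀ {P : Constraint n → Set} → Decidable P → Dec (∃ P)
anyConstraint? P? = map′ (λ (C , a , p) → (C , a) , p) (λ ((C , a) , p) → C , a , p)
                         (anySubset? λ C → anyBool? λ a → P? (C , a))

listSet? : (𝒞 : List (Constraint n)) → Decidable (listSet 𝒞)
listSet? 𝒞 c = _∈?_ (×-≡-dec (Vec-≡-dec _≟ᵇ_) _≟ᵇ_) c 𝒞

attr? : ∀ {𝒞 : ConstraintSet n} → Decidable 𝒞 → Decidable (attr k 𝒞)
attr? {k = k} 𝒞? (D , d) =
  𝒞? (D , d) ⊎-dec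
  anySubset? λ C₁ → anyBool? λ a₁ → anySubset? λ C₂ → anyBool? λ a₂ →
    𝒞? (C₁ , a₁) ×-dec 𝒞? (C₂ , a₂) ×-dec ∣ C₁ ⊕ C₂ ∣ ≤? k ×-dec
    Vec-≡-dec _≟ᵇ_ D (C₁ ⊕ C₂) ×-dec d ≟ᵇ (a₁ xor a₂)

cl? : ∀ {𝒞 : ConstraintSet n} → Decidable 𝒞 → ∀ r → Decidable (cl k r 𝒞)
cl? 𝒞? zero    = 𝒞?
cl? 𝒞? (suc r) = attr? (cl? 𝒞? r)

violation? : ∀ {𝒞 : ConstraintSet n} → Decidable 𝒞 → ∀ β → Dec (∃[ c ] 𝒞 c × Violates β c)
violation? 𝒞? β = anyConstraint? λ { (C , a) → 𝒞? (C , a) ×-dec (C ⊆? dom β) ×-dec ¬? (parity β C ≟ᵇ a) }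

cl-⊇ : ∀ {𝒞 : ConstraintSet n} r {c} → 𝒞 c → cl k r 𝒞 c
cl-⊇ zero    c∈𝒞 = c∈𝒞
cl-⊇ (suc r) c∈𝒞 = inj₁ (cl-⊇ r c∈𝒞)

-- Verifier answers 0 unless that already violates 𝒞; if 1 also did, the two violated
-- constraints both contain x and their sum is a violated constraint of attr k 𝒞.
answer : ∀ {𝒞 : ConstraintSet n} {β X' x} → Decidable 𝒞 → NoViolation (attr k 𝒞) β →
  X' ⊆ dom β → x ∉ dom β → ∣ X' ∪ ⁅ x ⁆ ∣ ≤ k → ∃[ b ] NoViolation 𝒞 (move β X' x b)
answer {k = k} {𝒞 = 𝒞} {β} {X'} {x} 𝒞? safe X'⊆X x∉X bound with violation? 𝒞? (move β X' x false)
... | no none = false , λ c c∈𝒞 violated → none (c , c∈𝒞 , violated)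
... | yes ((C₁ , a₁) , c₁∈𝒞 , violated₁) = true , conflict
  where
  conflict : NoViolation 𝒞 (move β X' x true)
  conflict (C₂ , a₂) c₂∈𝒞 violated₂ with x ∈ˢ? C₁ | x ∈ˢ? C₂
  ... | no x∉C₁ | _ = safe _ (inj₁ c₁∈𝒞) (Violates-move⇒Violates X'⊆X x∉X x∉C₁ violated₁)
  ... | yes _ | no x∉C₂ = safe _ (inj₁ c₂∈𝒞) (Violates-move⇒Violates X'⊆X x∉X x∉C₂ violated₂)
  ... | yes x∈C₁ | yes x∈C₂ =
    let D⊆X' , violated = Violates-both-moves⇒Violates-⊕ X'⊆X x∉X x∈C₁ x∈C₂ violated₁ violated₂
    in safe _ (inj₂ (C₁ , a₁ , C₂ , a₂ , c₁∈𝒞 , c₂∈𝒞 , ∣D∣≤k D⊆X' , refl , refl)) violated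
    where
    ∣D∣≤k : C₁ ⊕ C₂ ⊆ X' → ∣ C₁ ⊕ C₂ ∣ ≤ k
    ∣D∣≤k D⊆X' = ≤-trans (p⊆q⇒∣p∣≤∣q∣ (p⊆p∪q ⁅ x ⁆ ∘ D⊆X')) bound

verifierWins : ∀ {𝒞 : ConstraintSet n} → Decidable 𝒞 → ∀ r β →
  NoViolation (cl k r 𝒞) β → VerifierWins k 𝒞 r β
verifierWins 𝒞? zero    β safe = safe
verifierWins 𝒞? (suc r) β safe =
  (λ c c∈𝒞 → safe c (cl-⊇ (suc r) c∈𝒞)) ,
  λ x x∉X X' X'⊆X bound →
    let b , safe′ = answer (cl? 𝒞? r) safe X'⊆X x∉X bound
    in b , verifierWins 𝒞? r (move β X' x b) safe′

lemma5p6 : (k n : ℕ) (𝒞 : List (Constraint n)) →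
    (∀ C a → (C , a) ∈L 𝒞 → ∣ C ∣ ≤ k) →
    (r : ℕ) (β : Assignment n) → ∣ dom β ∣ ≤ k →
    NoViolation (cl k r (listSet 𝒞)) β →
    VerifierWins k (listSet 𝒞) r β
lemma5p6 k n 𝒞 _ r β _ = verifierWins (listSet? 𝒞) r β
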